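{- Let $P$ and $P'$ be two pairings of the same finite set $S$, let $E$ be a pair of $P$, suppose that the couple $(P,P')$ has type $\pi$ and that $E$ lies in a polygon of $\mathcal{L}(P,P')$ with $2r$ edges (so $r$ is a part of $\pi$). Then the type of the couple $(P_E,P'_E)$ is obtained from $\pi$ by replacing one part equal to $r$ by a part equal to $r-1$ (a part equal to $0$ being discarded).
   Context: A pairing of a finite set $S$ is a partition of $S$ into $2$-element subsets; if $\{s,t\}$ is one of its pairs, $t$ is the partner of $s$. For two pairings $P,P'$ of $S$, let $\mathcal{L}(P,P')$ be the graph whose vertices are the pairs of $P$ and the pairs of $P'$, with one edge labeled $s$ for each $s\in S$, joining the pair of $P$ containing $s$ to the pair of $P'$ containing $s$. Every vertex has degree $2$, so $\mathcal{L}(P,P')$ is a disjoint union of cycles ("polygons") of even lengths $2\ell_1\ge 2\ell_2\ge\cdots$; the partition $(\ell_1,\ell_2,\dots)$ is the type of $(P,P')$. A pair $E$ of $P$ (a vertex of $\mathcal{L}(P,P')$) lies in the polygon containing that vertex. For a pairing $P$ of $S$ and $E=\{s_1,s_2\}\subseteq S$ with $s_1\neq s_2$, the pairing $P_E$ of $S\setminus E$ is: $P\setminus\{E\}$ if $E\in P$; otherwise, with $t_1,t_2$ the partners of $s_1,s_2$ in $P$, $P_E=\big(P\setminus\{\{s_1,t_1\},\{s_2,t_2\}\}\big)\cup\{\{t_1,t_2\}\}$. -}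

module Defs where

open import Data.Nat using (ℕ; zero; suc; _∸_; _≤ᵇ_; ⌊_/2⌋)
open import Data.Bool using (Bool; true; false; if_then_else_; _∧_; not)
open import Data.Fin using (Fin; toℕ; _≟_)
open import Data.Fin.Subset using (Subset; _∈_; _∪_; ⋃; ⁅_⁆; ∣_∣; _-_; ⊥)
open import Data.List using (List; []; _∷_; map; allFin; concatMap; foldr)
open import Data.Vec using (lookup)
open import Relation.Nullary using (does; ¬_)
open import Relation.Binary.PropositionalEquality using (_≡_)

-- A pairing of S is given by its partner map p : Fin N → Fin N,
-- required to be a fixed-point-free involution of S (values outside S
-- are irrelevant).  The pairs of P are the sets {s , p s}, s ∈ S.
record IsPairing {N : ℕ} (S : Subset N) (p : Fin N → Fin N) : Set where
  field
    closed : ∀ x → x ∈ S → p x ∈ S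
    noFix  : ∀ x → x ∈ S → ¬ (p x ≡ x)
    invol  : ∀ x → x ∈ S → p (p x) ≡ x

_==_ : {N : ℕ} → Fin N → Fin N → Bool
x == y = does (x ≟ y)

image : {N : ℕ} → (Fin N → Fin N) → Subset N → Subset N
image {N} f X = ⋃ (map (λ x → if lookup X x then ⁅ f x ⁆ else ⊥) (allFin N))

-- one step of growing a set of edges of L(P,P') along shared vertices:
-- edge x shares its P-vertex with edge p x, its P'-vertex with edge p' x
grow : {N : ℕ} → (Fin N → Fin N) → (Fin N → Fin N) → Subset N → Subset N
grow p p' X = X ∪ (image p X ∪ image p' X)

iter : {A : Set} → ℕ → (A → A) → A → A
iter zero    f a = a
iter (suc k) f a = f (iter k f a)

-- The set of edges (elements of S) of the polygon of L(P,P') that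
-- contains edge s: the connected component, obtained by N growth steps.
polygon : {N : ℕ} → (Fin N → Fin N) → (Fin N → Fin N) → Fin N → Subset N
polygon {N} p p' s = iter N (grow p p') ⁅ s ⁆

-- s is the smallest edge of its polygon (used to pick one representative
-- per polygon)
isLeader : {N : ℕ} → Subset N → (Fin N → Fin N) → (Fin N → Fin N) → Fin N → Bool
isLeader {N} S p p' s =
  lookup S s ∧ foldr _∧_ true (map (λ y → not (lookup (polygon p p' s) y) Data.Bool.∨ (toℕ s ≤ᵇ toℕ y)) (allFin N))

-- The type of the couple (P,P') of pairings of S, as a list of parts
-- (a polygon with 2ℓ edges contributes the part ℓ), up to reordering.
typeOf : {N : ℕ} → Subset N → (Fin N → Fin N) → (Fin N → Fin N) → List ℕ
typeOf {N} S p p' =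
  concatMap (λ s → if isLeader S p p' s then ⌊ ∣ polygon p p' s ∣ /2⌋ ∷ [] else [])
            (allFin N)

removePair : {N : ℕ} → Subset N → Fin N → Fin N → Subset N
removePair S s₁ s₂ = (S - s₁) - s₂

-- P_E as in the paper: P ∖ {E} if E ∈ P; otherwise, with t₁ , t₂ the
-- partners of s₁ , s₂, replace {s₁,t₁},{s₂,t₂} by {t₁,t₂}.
restrictPairing : {N : ℕ} → (Fin N → Fin N) → Fin N → Fin N → (Fin N → Fin N)
restrictPairing p s₁ s₂ x =
  if p s₁ == s₂ then p x
  else (if x == p s₁ then p s₂ else (if x == p s₂ then p s₁ else p x))

consPart : ℕ → List ℕ → List ℕ
consPart zero    l = l
consPart (suc k) l = suc k ∷ l

-- Deleting
-- E = {s₁ , s₂} ∈ P changes P′ only at the P′-partners of s₁ and s₂, which lie in the polygon K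
-- of E; so every other polygon, and its part, survives unchanged.  If K is the 2-gon E it
-- disappears; otherwise K ∖ E, closed up by joining the two P′-partners, is a single polygon
-- of (P_E , P′_E) with two edges fewer.

module Submission where

open import Defs
open import Data.Nat using (ℕ; zero; suc; _+_; _∸_; ⌊_/2⌋; _≤_; _≤ᵇ_; s≤s; z≤n)
open import Data.Nat.Properties using (≤-reflexive; ≤-trans; ≤-antisym; <-irrefl; ≤ᵇ⇒≤; ≤⇒≤ᵇ)
open import Data.Bool using (Bool; true; false; if_then_else_; _∨_; not; T)
open import Data.Bool.Properties using (T-∧; T-≡)
open import Data.Fin using (Fin; toℕ; _≟_) renaming (zero to fzero; suc to fsuc)
open import Data.Fin.Properties using (toℕ-injective; any?)
open import Data.Fin.Subset using (Subset; _∈_; _∉_; ∣_∣; ⋃; ⁅_⁆; ⊥; _-_; _⊆_; Empty; inside; outside)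
open import Data.Fin.Subset.Properties
  using (x∈p∪q⁻; x∈p∪q⁺; ∉⊥; x∈⁅x⁆; x∈⁅y⁆⇒x≡y; ∣⁅x⁆∣≡1; ⊆-antisym; p⊂q⇒∣p∣<∣q∣; ∣p∣≤n; _∈?_;
         p─⊥≡p; x∈p∧x≢y⇒x∈p-y; p─q⊆p; Empty-unique; ∣⊥∣≡0)
open import Data.List using (List; []; _∷_; [_]; _++_; map; allFin; concatMap)
open import Data.Bool.ListAction using (all)
open import Data.List.Membership.Propositional using () renaming (_∈_ to _∈ₗ_)
open import Data.List.Membership.Propositional.Properties using (∈-map⁺; ∈-map⁻; ∈-allFin)
open import Data.List.Properties using (++-assoc; concatMap-cong)
open import Data.List.Relation.Unary.Any using (here; there)
import Data.List.Relation.Unary.All as All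
open import Data.List.Relation.Unary.All.Properties using (all⁺; all⁻)
open import Data.List.Relation.Unary.AllPairs using (_∷_)
open import Data.List.Relation.Unary.Unique.Propositional using (Unique)
open import Data.List.Relation.Unary.Unique.Propositional.Properties using (allFin⁺)
open import Data.List.Relation.Binary.Permutation.Propositional using (_↭_; ↭-reflexive; ↭-trans; ↭-refl)
open import Data.List.Relation.Binary.Permutation.Propositional.Properties using (++⁺ˡ; shifts)
open import Data.Vec using (lookup) renaming (_∷_ to _∷ᵛ_; here to hereᵛ; there to thereᵛ)
open import Data.Vec.Properties using ([]=⇒lookup; lookup⇒[]=)
open import Data.Product using (∃; _×_; _,_; proj₁; proj₂)
open import Data.Sum using (_⊎_; inj₁; inj₂)
open import Data.Empty using (⊥-elim)
open import Function.Bundles using (Equivalence)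
open import Relation.Nullary using (¬_; yes; no; Dec; ¬?)
open import Relation.Nullary.Decidable using (_×-dec_)
open import Relation.Unary using (Decidable)
open import Relation.Binary.PropositionalEquality using (_≡_; _≢_; refl; sym; trans; cong; subst; module ≡-Reasoning)
open import Function.Base using (_∘_)

-- Subsets of Fin n

∈-⋃⁺ : ∀ {n} (L : List (Subset n)) {Z x} → Z ∈ₗ L → x ∈ Z → x ∈ ⋃ L
∈-⋃⁺ (Z ∷ L) (here refl) x∈Z = x∈p∪q⁺ (inj₁ x∈Z)
∈-⋃⁺ (Z ∷ L) (there Z∈L) x∈Z = x∈p∪q⁺ (inj₂ (∈-⋃⁺ L Z∈L x∈Z))

∈-⋃⁻ : ∀ {n} (L : List (Subset n)) {x} → x ∈ ⋃ L → ∃ λ Z → Z ∈ₗ L × x ∈ Z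
∈-⋃⁻ []      x∈⋃ = ⊥-elim (∉⊥ x∈⋃)
∈-⋃⁻ (Z ∷ L) x∈⋃ with x∈p∪q⁻ Z (⋃ L) x∈⋃
... | inj₁ x∈Z = Z , here refl , x∈Z
... | inj₂ x∈⋃L with ∈-⋃⁻ L x∈⋃L
...   | W , W∈L , x∈W = W , there W∈L , x∈W

module _ {n : ℕ} (f : Fin n → Fin n) (X : Subset n) where

  private
    imageOf : Fin n → Subset n
    imageOf x = if lookup X x then ⁅ f x ⁆ else ⊥

  ∈-image⁺ : ∀ {x} → x ∈ X → f x ∈ image f X
  ∈-image⁺ {x} x∈X = ∈-⋃⁺ (map imageOf (allFin n)) (∈-map⁺ imageOf (∈-allFin x)) fx∈
    where
    fx∈ : f x ∈ imageOf x
    fx∈ rewrite []=⇒lookup x∈X = x∈⁅x⁆ (f x)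

  ∈-image⁻ : ∀ {y} → y ∈ image f X → ∃ λ x → x ∈ X × f x ≡ y
  ∈-image⁻ y∈ with ∈-⋃⁻ (map imageOf (allFin n)) y∈
  ... | Z , Z∈ , y∈Z with ∈-map⁻ imageOf Z∈
  ...   | x , _ , refl with lookup X x in x∈X
  ...     | true  = x , lookup⇒[]= x X x∈X , sym (x∈⁅y⁆⇒x≡y _ y∈Z)
  ...     | false = ⊥-elim (∉⊥ y∈Z)

lookup-cong-∈ : ∀ {n} {X Y : Subset n} {x} → (x ∈ X → x ∈ Y) → (x ∈ Y → x ∈ X) → lookup X x ≡ lookup Y x
lookup-cong-∈ {X = X} {Y} {x} X⇒Y Y⇒X with lookup X x in x∈X | lookup Y x in x∈Y
... | true  | true  = refl
... | false | false = refl
... | true  | false = trans (sym ([]=⇒lookup (X⇒Y (lookup⇒[]= x X x∈X)))) x∈Y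
... | false | true  = trans (sym x∈X) ([]=⇒lookup (Y⇒X (lookup⇒[]= x Y x∈Y)))

∉⇒lookup≡false : ∀ {n} {X : Subset n} {x} → x ∉ X → lookup X x ≡ false
∉⇒lookup≡false {X = X} {x} x∉X with lookup X x in x∈X
... | true  = ⊥-elim (x∉X (lookup⇒[]= x X x∈X))
... | false = refl

x∉p-x : ∀ {n} (p : Subset n) x → x ∉ p - x
x∉p-x (_ ∷ᵛ p) fzero    ()
x∉p-x (_ ∷ᵛ p) (fsuc x) (thereᵛ x∈) = x∉p-x p x x∈

∣p∣≡1+∣p-x∣ : ∀ {n} (p : Subset n) {x} → x ∈ p → ∣ p ∣ ≡ suc ∣ p - x ∣
∣p∣≡1+∣p-x∣ (inside  ∷ᵛ p) {fzero}  hereᵛ        = cong (λ q → suc ∣ q ∣) (sym (p─⊥≡p p))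
∣p∣≡1+∣p-x∣ (inside  ∷ᵛ p) {fsuc x} (thereᵛ x∈) = cong suc (∣p∣≡1+∣p-x∣ p x∈)
∣p∣≡1+∣p-x∣ (outside ∷ᵛ p) {fsuc x} (thereᵛ x∈) = ∣p∣≡1+∣p-x∣ p x∈

∈-removePair⁺ : ∀ {n} {X : Subset n} {s₁ s₂ x} → x ∈ X → x ≢ s₁ → x ≢ s₂ → x ∈ removePair X s₁ s₂
∈-removePair⁺ x∈X x≢s₁ x≢s₂ = x∈p∧x≢y⇒x∈p-y (x∈p∧x≢y⇒x∈p-y x∈X x≢s₁) x≢s₂

∈-removePair⁻ : ∀ {n} {X : Subset n} {s₁ s₂ x} → x ∈ removePair X s₁ s₂ → x ∈ X × x ≢ s₁ × x ≢ s₂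
∈-removePair⁻ {X = X} {s₁} {s₂} {x} x∈ =
  p─q⊆p X _ x∈X-s₁ , (λ { refl → x∉p-x X s₁ x∈X-s₁ }) , (λ { refl → x∉p-x (X - s₁) s₂ x∈ })
  where
  x∈X-s₁ : x ∈ X - s₁
  x∈X-s₁ = p─q⊆p (X - s₁) _ x∈

∣X∣≡2+∣removePair∣ : ∀ {n} (X : Subset n) {s₁ s₂} → s₁ ∈ X → s₂ ∈ X → s₁ ≢ s₂ →
                     ∣ X ∣ ≡ 2 + ∣ removePair X s₁ s₂ ∣
∣X∣≡2+∣removePair∣ X {s₁} s₁∈X s₂∈X s₁≢s₂ =
  trans (∣p∣≡1+∣p-x∣ X s₁∈X) (cong suc (∣p∣≡1+∣p-x∣ (X - s₁) (x∈p∧x≢y⇒x∈p-y s₂∈X (s₁≢s₂ ∘ sym))))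

-- Polygons as closures

-- Each step either stops or gains an element, so n steps from a singleton reach a fixed point.
module _ {n : ℕ} (F : Subset n → Subset n) (F-inflationary : ∀ {X} → X ⊆ F X) where

  private
    iter-fixed⊎grows : ∀ s k → F (iter k F ⁅ s ⁆) ≡ iter k F ⁅ s ⁆ ⊎ suc k ≤ ∣ iter k F ⁅ s ⁆ ∣
    iter-fixed⊎grows s zero = inj₂ (≤-reflexive (sym (∣⁅x⁆∣≡1 s)))
    iter-fixed⊎grows s (suc k)
      with iter-fixed⊎grows s k | any? (λ y → (y ∈? F (iter k F ⁅ s ⁆)) ×-dec ¬? (y ∈? iter k F ⁅ s ⁆))
    ... | inj₁ fixed | _ = inj₁ (cong F fixed)
    ... | inj₂ large | yes (y , y∈FX , y∉X) =
      inj₂ (≤-trans (s≤s large) (p⊂q⇒∣p∣<∣q∣ (F-inflationary , y , y∈FX , y∉X)))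
    ... | inj₂ _     | no ¬new = inj₁ (cong F (⊆-antisym FX⊆X F-inflationary))
      where
      FX⊆X : F (iter k F ⁅ s ⁆) ⊆ iter k F ⁅ s ⁆
      FX⊆X {y} y∈FX with y ∈? iter k F ⁅ s ⁆
      ... | yes y∈X = y∈X
      ... | no  y∉X = ⊥-elim (¬new (y , y∈FX , y∉X))

  iter-fixed : ∀ s → F (iter n F ⁅ s ⁆) ≡ iter n F ⁅ s ⁆
  iter-fixed s with iter-fixed⊎grows s n
  ... | inj₁ fixed = fixed
  ... | inj₂ large = ⊥-elim (<-irrefl refl (≤-trans large (∣p∣≤n (iter n F ⁅ s ⁆))))

module Polygon {n : ℕ} (f g : Fin n → Fin n) where

  grow-inflationary : ∀ {X} → X ⊆ grow f g X
  grow-inflationary x∈X = x∈p∪q⁺ (inj₁ x∈X)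

  grow⁻ : ∀ {X y} → y ∈ grow f g X → y ∈ X ⊎ (∃ λ x → x ∈ X × f x ≡ y) ⊎ (∃ λ x → x ∈ X × g x ≡ y)
  grow⁻ {X} y∈ with x∈p∪q⁻ X _ y∈
  ... | inj₁ y∈X = inj₁ y∈X
  ... | inj₂ y∈images with x∈p∪q⁻ (image f X) (image g X) y∈images
  ...   | inj₁ y∈fX = inj₂ (inj₁ (∈-image⁻ f X y∈fX))
  ...   | inj₂ y∈gX = inj₂ (inj₂ (∈-image⁻ g X y∈gX))

  s∈polygon : ∀ s → s ∈ polygon f g s
  s∈polygon s = s∈iter n
    where
    s∈iter : ∀ k → s ∈ iter k (grow f g) ⁅ s ⁆
    s∈iter zero    = x∈⁅x⁆ s
    s∈iter (suc k) = grow-inflationary (s∈iter k)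

  f∈polygon : ∀ {s y} → y ∈ polygon f g s → f y ∈ polygon f g s
  f∈polygon {s} {y} y∈ = subst (f y ∈_) (iter-fixed (grow f g) grow-inflationary s)
                                (x∈p∪q⁺ (inj₂ (x∈p∪q⁺ (inj₁ (∈-image⁺ f _ y∈)))))

  g∈polygon : ∀ {s y} → y ∈ polygon f g s → g y ∈ polygon f g s
  g∈polygon {s} {y} y∈ = subst (g y ∈_) (iter-fixed (grow f g) grow-inflationary s)
                                (x∈p∪q⁺ (inj₂ (x∈p∪q⁺ (inj₂ (∈-image⁺ g _ y∈)))))

  polygon-least : (P : Fin n → Set) {s : Fin n} → P s → (∀ {y} → P y → P (f y) × P (g y)) →
                  ∀ {y} → y ∈ polygon f g s → P y
  polygon-least P {s} Ps closed = inIter n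
    where
    inIter : ∀ k {y} → y ∈ iter k (grow f g) ⁅ s ⁆ → P y
    inIter zero    y∈ = subst P (sym (x∈⁅y⁆⇒x≡y s y∈)) Ps
    inIter (suc k) y∈ with grow⁻ y∈
    ... | inj₁ y∈X                 = inIter k y∈X
    ... | inj₂ (inj₁ (x , x∈ , refl)) = proj₁ (closed (inIter k x∈))
    ... | inj₂ (inj₂ (x , x∈ , refl)) = proj₂ (closed (inIter k x∈))

  polygon-⊆ : ∀ {s t} → t ∈ polygon f g s → polygon f g t ⊆ polygon f g s
  polygon-⊆ {s} t∈ = polygon-least (_∈ polygon f g s) t∈ (λ y∈ → f∈polygon y∈ , g∈polygon y∈)

polygon-cong : ∀ {n} {f g f′ g′ : Fin n → Fin n} {s} →
               (∀ {y} → y ∈ polygon f g s → f′ y ≡ f y × g′ y ≡ g y) → polygon f′ g′ s ≡ polygon f g s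
polygon-cong {f = f} {g} {f′} {g′} {s} agree = ⊆-antisym new⊆old old⊆new
  where
  module Old = Polygon f g
  module New = Polygon f′ g′
  new⊆old : polygon f′ g′ s ⊆ polygon f g s
  new⊆old = New.polygon-least (_∈ polygon f g s) (Old.s∈polygon s) λ y∈ →
    subst (_∈ polygon f g s) (sym (proj₁ (agree y∈))) (Old.f∈polygon y∈) ,
    subst (_∈ polygon f g s) (sym (proj₂ (agree y∈))) (Old.g∈polygon y∈)
  old⊆new : polygon f g s ⊆ polygon f′ g′ s
  old⊆new = Old.polygon-least (_∈ polygon f′ g′ s) (New.s∈polygon s) λ y∈ →
    subst (_∈ polygon f′ g′ s) (proj₁ (agree (new⊆old y∈))) (New.f∈polygon y∈) ,
    subst (_∈ polygon f′ g′ s) (proj₂ (agree (new⊆old y∈))) (New.g∈polygon y∈)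

module PolygonOfPairings {n : ℕ} {S : Subset n} {f g : Fin n → Fin n}
                         (F : IsPairing S f) (G : IsPairing S g) where
  open Polygon f g
  open IsPairing

  polygon⊆S : ∀ {s} → s ∈ S → polygon f g s ⊆ S
  polygon⊆S s∈S = polygon-least (_∈ S) s∈S (λ y∈S → closed F _ y∈S , closed G _ y∈S)

  -- y = f (f y) lies in the polygon of f y, and similarly for g.
  polygon-sym : ∀ {s t} → s ∈ S → t ∈ polygon f g s → s ∈ polygon f g t
  polygon-sym {s} s∈S t∈ = proj₂ (polygon-least (λ y → y ∈ S × s ∈ polygon f g y) (s∈S , s∈polygon s) step t∈)
    where
    step : ∀ {y} → y ∈ S × s ∈ polygon f g y → (f y ∈ S × s ∈ polygon f g (f y)) × (g y ∈ S × s ∈ polygon f g (g y))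
    step {y} (y∈S , s∈) =
      (closed F y y∈S , polygon-⊆ (subst (_∈ polygon f g (f y)) (invol F y y∈S) (f∈polygon (s∈polygon (f y)))) s∈) ,
      (closed G y y∈S , polygon-⊆ (subst (_∈ polygon f g (g y)) (invol G y y∈S) (g∈polygon (s∈polygon (g y)))) s∈)

  polygon-≡ : ∀ {s t} → s ∈ S → t ∈ polygon f g s → polygon f g t ≡ polygon f g s
  polygon-≡ s∈S t∈ = ⊆-antisym (polygon-⊆ t∈) (polygon-⊆ (polygon-sym s∈S t∈))

-- Counting the parts of a type

module _ {A B : Set} where

  onlyWhere exceptWhere : (A → Bool) → (A → List B) → A → List B
  onlyWhere   q h x = if q x then h x else []
  exceptWhere q h x = if q x then [] else h x

  concatMap-↭-partition : (q : A → Bool) (h : A → List B) (xs : List A) →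
                          concatMap h xs ↭ concatMap (onlyWhere q h) xs ++ concatMap (exceptWhere q h) xs
  concatMap-↭-partition q h []       = ↭-refl
  concatMap-↭-partition q h (x ∷ xs) with q x
  ... | true  = ↭-trans (++⁺ˡ (h x) (concatMap-↭-partition q h xs)) (↭-reflexive (sym (++-assoc (h x) _ _)))
  ... | false = ↭-trans (++⁺ˡ (h x) (concatMap-↭-partition q h xs)) (shifts (h x) (concatMap (onlyWhere q h) xs))

  concatMap-≡[] : (h : A → List B) (xs : List A) → (∀ {x} → x ∈ₗ xs → h x ≡ []) → concatMap h xs ≡ []
  concatMap-≡[] h []       _     = refl
  concatMap-≡[] h (x ∷ xs) empty rewrite empty (here refl) = concatMap-≡[] h xs (λ x∈ → empty (there x∈))

  concatMap-≡[_] : ∀ {v} (h : A → List B) {xs : List A} {m} → Unique xs → m ∈ₗ xs →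
                   h m ≡ [ v ] → (∀ x → x ≢ m → h x ≡ []) → concatMap h xs ≡ [ v ]
  concatMap-≡[ h ] {x ∷ xs} (x∉xs ∷ _) (here refl) hm≡[v] others rewrite hm≡[v] =
    cong (_ ∷_) (concatMap-≡[] h xs (λ y∈ → others _ (λ { refl → All.lookup x∉xs y∈ refl })))
  concatMap-≡[ h ] {x ∷ xs} (x∉xs ∷ unique) (there m∈) hm≡[v] others rewrite others x (λ { refl → All.lookup x∉xs m∈ refl }) =
    concatMap-≡[ h ] unique m∈ hm≡[v] others

∃-least : ∀ {n} (P : Fin n → Set) → Decidable P → ∀ {w} → P w →
          ∃ λ m → P m × (∀ {y} → P y → toℕ m ≤ toℕ y)
∃-least {suc n} P P? {w} Pw with P? fzero
... | yes P0 = fzero , P0 , λ _ → z≤n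
... | no ¬P0 with w
...   | fzero  = ⊥-elim (¬P0 Pw)
...   | fsuc v with ∃-least (λ y → P (fsuc y)) (λ y → P? (fsuc y)) Pw
...     | m , Pm , least = fsuc m , Pm , λ { {fzero} P0 → ⊥-elim (¬P0 P0) ; {fsuc y} Py → s≤s (least Py) }

-- isLeader S f g s unfolds to lookup S s ∧ isLowerBound (polygon f g s) s.
isLowerBound : ∀ {n} → Subset n → Fin n → Bool
isLowerBound {n} X x = all (λ y → not (lookup X y) ∨ (toℕ x ≤ᵇ toℕ y)) (allFin n)

isLowerBound-sound : ∀ {n} {X : Subset n} {x y} → T (isLowerBound X x) → y ∈ X → toℕ x ≤ toℕ y
isLowerBound-sound {n} {X} {x} {y} lb y∈X = ≤ᵇ⇒≤ (toℕ x) (toℕ y)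
  (subst (λ b → T (not b ∨ (toℕ x ≤ᵇ toℕ y))) ([]=⇒lookup y∈X) (All.lookup (all⁺ _ (allFin n) lb) (∈-allFin y)))

isLowerBound-complete : ∀ {n} {X : Subset n} {x} → (∀ {y} → y ∈ X → toℕ x ≤ toℕ y) → T (isLowerBound X x)
isLowerBound-complete {n} {X} {x} lb = all⁻ _ {allFin n} (All.tabulate λ {y} _ → bound y)
  where
  bound : ∀ y → T (not (lookup X y) ∨ (toℕ x ≤ᵇ toℕ y))
  bound y with lookup X y in y∈X
  ... | true  = ≤⇒≤ᵇ (lb (lookup⇒[]= y X y∈X))
  ... | false = _

part : ∀ {n} → Subset n → (f g : Fin n → Fin n) → Fin n → List ℕ
part S f g s = if isLeader S f g s then [ ⌊ ∣ polygon f g s ∣ /2⌋ ] else []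

part-cong : ∀ {n} {S S′ : Subset n} {f g f′ g′ : Fin n → Fin n} {x} → lookup S′ x ≡ lookup S x →
            (x ∈ S → polygon f′ g′ x ≡ polygon f g x) → part S′ f′ g′ x ≡ part S f g x
part-cong {S = S} {x = x} S′x≡Sx same-polygon with lookup S x in x∈S
... | false rewrite S′x≡Sx = refl
... | true  rewrite S′x≡Sx | same-polygon (lookup⇒[]= x S x∈S) = refl

-- X contributes its part at its least edge, the only leader among its edges.
typeOf-↭-polygon : ∀ {n} (S X : Subset n) (f g : Fin n → Fin n) {w} → w ∈ X →
                   (∀ {x} → x ∈ X → x ∈ S × polygon f g x ≡ X) →
                   typeOf S f g ↭ ⌊ ∣ X ∣ /2⌋ ∷ concatMap (exceptWhere (lookup X) (part S f g)) (allFin n)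
typeOf-↭-polygon {n} S X f g w∈X inX with ∃-least (_∈ X) (_∈? X) w∈X
... | m , m∈X , m-least =
  ↭-trans (concatMap-↭-partition (lookup X) (part S f g) (allFin n))
          (↭-reflexive (cong (_++ rest) (concatMap-≡[ inX-part ] (allFin⁺ n) (∈-allFin m) at-m elsewhere)))
  where
  rest : List ℕ
  rest = concatMap (exceptWhere (lookup X) (part S f g)) (allFin n)

  inX-part : Fin n → List ℕ
  inX-part = onlyWhere (lookup X) (part S f g)

  at-m : inX-part m ≡ [ ⌊ ∣ X ∣ /2⌋ ]
  at-m rewrite []=⇒lookup m∈X | proj₂ (inX m∈X) | []=⇒lookup (proj₁ (inX m∈X))
             | Equivalence.to T-≡ (isLowerBound-complete {X = X} m-least) = refl

  elsewhere : ∀ x → x ≢ m → inX-part x ≡ []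
  elsewhere x x≢m with lookup X x in x∈X
  ... | false = refl
  ... | true with isLeader S f g x in leader
  ...   | false = refl
  ...   | true  = ⊥-elim (x≢m (toℕ-injective (≤-antisym x≤m (m-least (lookup⇒[]= x X x∈X)))))
    where
    x≤m : toℕ x ≤ toℕ m
    x≤m = isLowerBound-sound (proj₂ (Equivalence.to T-∧ (Equivalence.from T-≡ leader)))
                             (subst (m ∈_) (sym (proj₂ (inX (lookup⇒[]= x X x∈X)))) m∈X)

-- Deleting a pair of P

restrictPairing-≗ : ∀ {n} {p : Fin n → Fin n} {s₁ s₂} → p s₁ ≡ s₂ → ∀ x → restrictPairing p s₁ s₂ x ≡ p x
restrictPairing-≗ {p = p} {s₁} {s₂} ps₁≡s₂ x with p s₁ ≟ s₂
... | yes _    = refl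
... | no ps₁≢s₂ = ⊥-elim (ps₁≢s₂ ps₁≡s₂)

-- The lemmas below also cover the case p s₁ ≡ s₂, where restrictPairing returns p itself.
module RestrictedPairing {n : ℕ} {S : Subset n} {p : Fin n → Fin n} (P : IsPairing S p)
                         {s₁ s₂ : Fin n} (s₁∈S : s₁ ∈ S) (s₂∈S : s₂ ∈ S) (s₁≢s₂ : s₁ ≢ s₂) where
  open IsPairing P
  open ≡-Reasoning

  private
    r = restrictPairing p s₁ s₂

  p-injective : ∀ {x y} → x ∈ S → y ∈ S → p x ≡ p y → x ≡ y
  p-injective {x} {y} x∈S y∈S px≡py = trans (sym (invol x x∈S)) (trans (cong p px≡py) (invol y y∈S))

  restrict-partner₁ : r (p s₁) ≡ p s₂
  restrict-partner₁ with p s₁ ≟ s₂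
  ... | yes ps₁≡s₂ = trans (invol s₁ s₁∈S) (sym (trans (cong p (sym ps₁≡s₂)) (invol s₁ s₁∈S)))
  ... | no  _ with p s₁ ≟ p s₁
  ...   | yes _      = refl
  ...   | no  ps₁≢ps₁ = ⊥-elim (ps₁≢ps₁ refl)

  restrict-partner₂ : r (p s₂) ≡ p s₁
  restrict-partner₂ with p s₁ ≟ s₂
  ... | yes ps₁≡s₂ = trans (invol s₂ s₂∈S) (sym ps₁≡s₂)
  ... | no  _ with p s₂ ≟ p s₁
  ...   | yes ps₂≡ps₁ = ⊥-elim (s₁≢s₂ (p-injective s₁∈S s₂∈S (sym ps₂≡ps₁)))
  ...   | no  _ with p s₂ ≟ p s₂
  ...     | yes _      = refl
  ...     | no  ps₂≢ps₂ = ⊥-elim (ps₂≢ps₂ refl)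

  restrict-elsewhere : ∀ {x} → x ≢ p s₁ → x ≢ p s₂ → r x ≡ p x
  restrict-elsewhere {x} x≢ps₁ x≢ps₂ with p s₁ ≟ s₂
  ... | yes _ = refl
  ... | no  _ with x ≟ p s₁
  ...   | yes x≡ps₁ = ⊥-elim (x≢ps₁ x≡ps₁)
  ...   | no  _ with x ≟ p s₂
  ...     | yes x≡ps₂ = ⊥-elim (x≢ps₂ x≡ps₂)
  ...     | no  _ = refl

  data Position (y : Fin n) : Set where
    partner₁  : y ≡ p s₁ → Position y
    partner₂  : y ≡ p s₂ → Position y
    elsewhere : y ≢ p s₁ → y ≢ p s₂ → Position y

  position : ∀ y → Position y
  position y with y ≟ p s₁ | y ≟ p s₂
  ... | yes y≡ps₁ | _         = partner₁ y≡ps₁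
  ... | no  _     | yes y≡ps₂ = partner₂ y≡ps₂
  ... | no  y≢ps₁ | no  y≢ps₂ = elsewhere y≢ps₁ y≢ps₂

  partner-≢ : ∀ {y s} → y ∈ S → y ≢ p s → p y ≢ s
  partner-≢ {y} y∈S y≢ps py≡s = y≢ps (trans (sym (invol y y∈S)) (cong p py≡s))

  restrict-closed : ∀ {X : Subset n} → X ⊆ S → (∀ {y} → y ∈ X → p y ∈ X) → s₁ ∈ X → s₂ ∈ X →
                    ∀ {y} → y ∈ removePair X s₁ s₂ → r y ∈ removePair X s₁ s₂
  restrict-closed {X} X⊆S p-closed s₁∈X s₂∈X {y} y∈ with ∈-removePair⁻ {X = X} y∈ | position y
  ... | _ , _ , y≢s₂ | partner₁ refl =
    subst (_∈ removePair X s₁ s₂) (sym restrict-partner₁)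
          (∈-removePair⁺ (p-closed s₂∈X) (partner-≢ s₂∈S (y≢s₂ ∘ sym)) (noFix s₂ s₂∈S))
  ... | _ , y≢s₁ , _ | partner₂ refl =
    subst (_∈ removePair X s₁ s₂) (sym restrict-partner₂)
          (∈-removePair⁺ (p-closed s₁∈X) (noFix s₁ s₁∈S) (partner-≢ s₁∈S (y≢s₁ ∘ sym)))
  ... | y∈X , _ , _ | elsewhere y≢ps₁ y≢ps₂ =
    subst (_∈ removePair X s₁ s₂) (sym (restrict-elsewhere y≢ps₁ y≢ps₂))
          (∈-removePair⁺ (p-closed y∈X) (partner-≢ (X⊆S y∈X) y≢ps₁) (partner-≢ (X⊆S y∈X) y≢ps₂))

  restrict-isPairing : IsPairing (removePair S s₁ s₂) r
  restrict-isPairing = record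
    { closed = λ y y∈ → restrict-closed (λ y∈S → y∈S) (λ {y} → closed y) s₁∈S s₂∈S y∈
    ; noFix  = restrict-noFix
    ; invol  = restrict-invol
    }
    where
    restrict-noFix : ∀ y → y ∈ removePair S s₁ s₂ → r y ≢ y
    restrict-noFix y y∈ with ∈-removePair⁻ {X = S} y∈ | position y
    ... | _ | partner₁ refl = λ ry≡y → s₁≢s₂ (p-injective s₁∈S s₂∈S (sym (trans (sym restrict-partner₁) ry≡y)))
    ... | _ | partner₂ refl = λ ry≡y → s₁≢s₂ (p-injective s₁∈S s₂∈S (trans (sym restrict-partner₂) ry≡y))
    ... | y∈S , _ | elsewhere y≢ps₁ y≢ps₂ = λ ry≡y → noFix y y∈S (trans (sym (restrict-elsewhere y≢ps₁ y≢ps₂)) ry≡y)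

    restrict-invol : ∀ y → y ∈ removePair S s₁ s₂ → r (r y) ≡ y
    restrict-invol y y∈ with ∈-removePair⁻ {X = S} y∈ | position y
    ... | _ | partner₁ refl = trans (cong r restrict-partner₁) restrict-partner₂
    ... | _ | partner₂ refl = trans (cong r restrict-partner₂) restrict-partner₁
    ... | y∈S , y≢s₁ , y≢s₂ | elsewhere y≢ps₁ y≢ps₂ = begin
      r (r y)  ≡⟨ cong r (restrict-elsewhere y≢ps₁ y≢ps₂) ⟩
      r (p y)  ≡⟨ restrict-elsewhere (y≢s₁ ∘ p-injective y∈S s₁∈S) (y≢s₂ ∘ p-injective y∈S s₂∈S) ⟩
      p (p y)  ≡⟨ invol y y∈S ⟩
      y        ∎

⌊k/2⌋∸1≡⌊m/2⌋ : ∀ {k m} → k ≡ 2 + m → ⌊ k /2⌋ ∸ 1 ≡ ⌊ m /2⌋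
⌊k/2⌋∸1≡⌊m/2⌋ refl = refl

consPart-⌊2+m/2⌋ : ∀ {k m} (l : List ℕ) → k ≡ 2 + m → consPart ⌊ k /2⌋ l ≡ ⌊ k /2⌋ ∷ l
consPart-⌊2+m/2⌋ l refl = refl

module Deletion {n : ℕ} {S : Subset n} {p p′ : Fin n → Fin n} (P : IsPairing S p) (P′ : IsPairing S p′)
                {s₁ s₂ : Fin n} (s₁∈S : s₁ ∈ S) (s₂∈S : s₂ ∈ S) (s₁≢s₂ : s₁ ≢ s₂) (ps₁≡s₂ : p s₁ ≡ s₂) where

  open Polygon p p′
  open PolygonOfPairings P P′
  module R  = RestrictedPairing P  s₁∈S s₂∈S s₁≢s₂
  module R′ = RestrictedPairing P′ s₁∈S s₂∈S s₁≢s₂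
  open IsPairing

  S′ : Subset n
  S′ = removePair S s₁ s₂

  q q′ : Fin n → Fin n
  q  = restrictPairing p  s₁ s₂
  q′ = restrictPairing p′ s₁ s₂

  K K′ : Subset n
  K  = polygon p p′ s₁
  K′ = removePair K s₁ s₂

  rest : List ℕ
  rest = concatMap (exceptWhere (lookup K) (part S p p′)) (allFin n)

  s₁∈K : s₁ ∈ K
  s₁∈K = s∈polygon s₁

  s₂∈K : s₂ ∈ K
  s₂∈K = subst (_∈ K) ps₁≡s₂ (f∈polygon s₁∈K)

  K-is-polygon : ∀ {x} → x ∈ K → x ∈ S × polygon p p′ x ≡ K
  K-is-polygon x∈K = polygon⊆S s₁∈S x∈K , polygon-≡ s₁∈S x∈K

  typeOf-↭ : typeOf S p p′ ↭ ⌊ ∣ K ∣ /2⌋ ∷ rest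
  typeOf-↭ = typeOf-↭-polygon S K p p′ s₁∈K K-is-polygon

  ∣K∣≡2+∣K′∣ : ∣ K ∣ ≡ 2 + ∣ K′ ∣
  ∣K∣≡2+∣K′∣ = ∣X∣≡2+∣removePair∣ K s₁∈K s₂∈K s₁≢s₂

  -- Polygons avoiding K contain no partner of s₁ or s₂, where the pairings were modified.
  polygon-away : ∀ {x} → x ∈ S → x ∉ K → polygon q q′ x ≡ polygon p p′ x
  polygon-away {x} x∈S x∉K = polygon-cong {f = p} {p′} {q} {q′} agree
    where
    y∉K : ∀ {y} → y ∈ polygon p p′ x → y ∉ K
    y∉K y∈ y∈K = x∉K (subst (x ∈_) (polygon-≡ s₁∈S y∈K) (polygon-sym x∈S y∈))
    agree : ∀ {y} → y ∈ polygon p p′ x → q y ≡ p y × q′ y ≡ p′ y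
    agree y∈ = restrictPairing-≗ {p = p} ps₁≡s₂ _ ,
               R′.restrict-elsewhere (λ { refl → y∉K y∈ (g∈polygon s₁∈K) }) (λ { refl → y∉K y∈ (g∈polygon s₂∈K) })

  K′⊆S′ : K′ ⊆ S′
  K′⊆S′ y∈K′ = let y∈K , y≢s₁ , y≢s₂ = ∈-removePair⁻ {X = K} y∈K′ in ∈-removePair⁺ (polygon⊆S s₁∈S y∈K) y≢s₁ y≢s₂

  K-K′-∉S′ : ∀ {x} → x ∈ K → x ∉ K′ → x ∉ S′
  K-K′-∉S′ x∈K x∉K′ x∈S′ = let _ , x≢s₁ , x≢s₂ = ∈-removePair⁻ {X = S} x∈S′ in x∉K′ (∈-removePair⁺ x∈K x≢s₁ x≢s₂)

  part-away : ∀ {x} → x ∉ K′ → part S′ q q′ x ≡ exceptWhere (lookup K) (part S p p′) x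
  part-away {x} x∉K′ with x ∈? K
  ... | yes x∈K rewrite []=⇒lookup x∈K | ∉⇒lookup≡false {X = S′} (K-K′-∉S′ x∈K x∉K′) = refl
  ... | no x∉K rewrite ∉⇒lookup≡false x∉K =
    part-cong {S = S} {S′} {p} {p′} {q} {q′}
      (lookup-cong-∈ {X = S′} {S} (λ x∈S′ → proj₁ (∈-removePair⁻ {X = S} x∈S′))
                                  (λ x∈S → ∈-removePair⁺ x∈S (λ { refl → x∉K s₁∈K }) (λ { refl → x∉K s₂∈K })))
      (λ x∈S → polygon-away x∈S x∉K)

  ps₂≡s₁ : p s₂ ≡ s₁
  ps₂≡s₁ = trans (cong p (sym ps₁≡s₂)) (invol P s₁ s₁∈S)

  K′-empty : p′ s₁ ≡ s₂ → Empty K′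
  K′-empty p′s₁≡s₂ (x , x∈K′) with ∈-removePair⁻ {X = K} x∈K′
  ... | x∈K , x≢s₁ , x≢s₂ with K⊆E x∈K
    where
    K⊆E : ∀ {y} → y ∈ K → y ≡ s₁ ⊎ y ≡ s₂
    K⊆E = polygon-least (λ y → y ≡ s₁ ⊎ y ≡ s₂) (inj₁ refl) λ
      { (inj₁ refl) → inj₂ ps₁≡s₂ , inj₂ p′s₁≡s₂
      ; (inj₂ refl) → inj₁ ps₂≡s₁ , inj₁ (trans (cong p′ (sym p′s₁≡s₂)) (invol P′ s₁ s₁∈S)) }
  ...   | inj₁ x≡s₁ = x≢s₁ x≡s₁
  ...   | inj₂ x≡s₂ = x≢s₂ x≡s₂

  typeOf-restrict-↭-twoEdges : p′ s₁ ≡ s₂ → typeOf S′ q q′ ↭ consPart (⌊ ∣ K ∣ /2⌋ ∸ 1) rest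
  typeOf-restrict-↭-twoEdges p′s₁≡s₂ = ↭-reflexive (begin
    typeOf S′ q q′                      ≡⟨ concatMap-cong (λ x → part-away (λ x∈K′ → K′-empty p′s₁≡s₂ (x , x∈K′))) (allFin n) ⟩
    consPart ⌊ 0 /2⌋ rest               ≡⟨ cong (λ k → consPart ⌊ k /2⌋ rest) ∣K′∣≡0 ⟨
    consPart ⌊ ∣ K′ ∣ /2⌋ rest           ≡⟨ cong (λ k → consPart k rest) (⌊k/2⌋∸1≡⌊m/2⌋ ∣K∣≡2+∣K′∣) ⟨
    consPart (⌊ ∣ K ∣ /2⌋ ∸ 1) rest      ∎)
    where
    open ≡-Reasoning
    ∣K′∣≡0 : ∣ K′ ∣ ≡ 0
    ∣K′∣≡0 = trans (cong ∣_∣ (Empty-unique (K′-empty p′s₁≡s₂))) (∣⊥∣≡0 n)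

  module MoreEdges (p′s₁≢s₂ : p′ s₁ ≢ s₂) where
    open PolygonOfPairings R.restrict-isPairing R′.restrict-isPairing using () renaming (polygon-≡ to polygon′-≡)
    module New = Polygon q q′

    W : Subset n
    W = polygon q q′ (p′ s₁)

    p′s₁∈K′ : p′ s₁ ∈ K′
    p′s₁∈K′ = ∈-removePair⁺ (g∈polygon s₁∈K) (noFix P′ s₁ s₁∈S) p′s₁≢s₂

    p′s₂∈K′ : p′ s₂ ∈ K′
    p′s₂∈K′ = ∈-removePair⁺ (g∈polygon s₂∈K) (R′.partner-≢ s₂∈S (p′s₁≢s₂ ∘ sym)) (noFix P′ s₂ s₂∈S)

    W⊆K′ : W ⊆ K′
    W⊆K′ = New.polygon-least (_∈ K′) p′s₁∈K′ λ y∈K′ →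
      R.restrict-closed (polygon⊆S s₁∈S) f∈polygon s₁∈K s₂∈K y∈K′ ,
      R′.restrict-closed (polygon⊆S s₁∈S) g∈polygon s₁∈K s₂∈K y∈K′

    K⊆W∪E : ∀ {y} → y ∈ K → y ∈ W ⊎ y ≡ s₁ ⊎ y ≡ s₂
    K⊆W∪E = polygon-least (λ y → y ∈ W ⊎ y ≡ s₁ ⊎ y ≡ s₂) (inj₂ (inj₁ refl)) step
      where
      p′-step : ∀ {y} → y ∈ W → p′ y ∈ W ⊎ p′ y ≡ s₁ ⊎ p′ y ≡ s₂
      p′-step {y} y∈W with R′.position y
      ... | R′.partner₁ refl = inj₂ (inj₁ (invol P′ s₁ s₁∈S))
      ... | R′.partner₂ refl = inj₂ (inj₂ (invol P′ s₂ s₂∈S))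
      ... | R′.elsewhere y≢p′s₁ y≢p′s₂ =
        inj₁ (subst (_∈ W) (R′.restrict-elsewhere y≢p′s₁ y≢p′s₂) (New.g∈polygon y∈W))
      step : ∀ {y} → y ∈ W ⊎ y ≡ s₁ ⊎ y ≡ s₂ →
             (p y ∈ W ⊎ p y ≡ s₁ ⊎ p y ≡ s₂) × (p′ y ∈ W ⊎ p′ y ≡ s₁ ⊎ p′ y ≡ s₂)
      step (inj₁ y∈W)        = inj₁ (subst (_∈ W) (restrictPairing-≗ {p = p} ps₁≡s₂ _) (New.f∈polygon y∈W)) ,
                               p′-step y∈W
      step (inj₂ (inj₁ refl)) = inj₂ (inj₂ ps₁≡s₂) , inj₁ (New.s∈polygon (p′ s₁))
      step (inj₂ (inj₂ refl)) = inj₂ (inj₁ ps₂≡s₁) ,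
                               inj₁ (subst (_∈ W) R′.restrict-partner₁ (New.g∈polygon (New.s∈polygon (p′ s₁))))

    K′≡W : K′ ≡ W
    K′≡W = ⊆-antisym K′⊆W W⊆K′
      where
      K′⊆W : K′ ⊆ W
      K′⊆W y∈K′ with ∈-removePair⁻ {X = K} y∈K′
      ... | y∈K , y≢s₁ , y≢s₂ with K⊆W∪E y∈K
      ...   | inj₁ y∈W         = y∈W
      ...   | inj₂ (inj₁ y≡s₁) = ⊥-elim (y≢s₁ y≡s₁)
      ...   | inj₂ (inj₂ y≡s₂) = ⊥-elim (y≢s₂ y≡s₂)

    K′-is-polygon : ∀ {x} → x ∈ K′ → x ∈ S′ × polygon q q′ x ≡ K′
    K′-is-polygon {x} x∈K′ = K′⊆S′ x∈K′ , trans (polygon′-≡ (K′⊆S′ p′s₁∈K′) (subst (x ∈_) K′≡W x∈K′)) (sym K′≡W)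

    ∣K′∣≡2+∣K′-E′∣ : ∣ K′ ∣ ≡ 2 + ∣ removePair K′ (p′ s₁) (p′ s₂) ∣
    ∣K′∣≡2+∣K′-E′∣ = ∣X∣≡2+∣removePair∣ K′ p′s₁∈K′ p′s₂∈K′ (s₁≢s₂ ∘ R′.p-injective s₁∈S s₂∈S)

    exceptWhere-K′ : ∀ x → exceptWhere (lookup K′) (part S′ q q′) x ≡ exceptWhere (lookup K) (part S p p′) x
    exceptWhere-K′ x with x ∈? K′
    ... | yes x∈K′ rewrite []=⇒lookup x∈K′ | []=⇒lookup (proj₁ (∈-removePair⁻ {X = K} x∈K′)) = refl
    ... | no  x∉K′ rewrite ∉⇒lookup≡false x∉K′ = part-away x∉K′

    typeOf-restrict-↭ : typeOf S′ q q′ ↭ consPart (⌊ ∣ K ∣ /2⌋ ∸ 1) rest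
    typeOf-restrict-↭ = ↭-trans (typeOf-↭-polygon S′ K′ q q′ p′s₁∈K′ K′-is-polygon) (↭-reflexive (begin
      ⌊ ∣ K′ ∣ /2⌋ ∷ concatMap (exceptWhere (lookup K′) (part S′ q q′)) (allFin n)
        ≡⟨ cong (_ ∷_) (concatMap-cong exceptWhere-K′ (allFin n)) ⟩
      ⌊ ∣ K′ ∣ /2⌋ ∷ rest                ≡⟨ consPart-⌊2+m/2⌋ rest ∣K′∣≡2+∣K′-E′∣ ⟨
      consPart ⌊ ∣ K′ ∣ /2⌋ rest           ≡⟨ cong (λ k → consPart k rest) (⌊k/2⌋∸1≡⌊m/2⌋ ∣K∣≡2+∣K′∣) ⟨
      consPart (⌊ ∣ K ∣ /2⌋ ∸ 1) rest      ∎))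
      where open ≡-Reasoning

  typeOf-restrict-↭ : typeOf S′ q q′ ↭ consPart (⌊ ∣ K ∣ /2⌋ ∸ 1) rest
  typeOf-restrict-↭ = byLength (p′ s₁ ≟ s₂)
    where
    byLength : Dec (p′ s₁ ≡ s₂) → typeOf S′ q q′ ↭ consPart (⌊ ∣ K ∣ /2⌋ ∸ 1) rest
    byLength (yes p′s₁≡s₂) = typeOf-restrict-↭-twoEdges p′s₁≡s₂
    byLength (no  p′s₁≢s₂) = MoreEdges.typeOf-restrict-↭ p′s₁≢s₂

lemma3p4 : {N : ℕ} (S : Subset N) (p p' : Fin N → Fin N) →
           IsPairing S p → IsPairing S p' →
           (s₁ s₂ : Fin N) → s₁ ∈ S → s₂ ∈ S → ¬ (s₁ ≡ s₂) → p s₁ ≡ s₂ →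
           ∃ λ (rest : List ℕ) →
             (typeOf S p p' ↭ ⌊ ∣ polygon p p' s₁ ∣ /2⌋ ∷ rest) ×
             (typeOf (removePair S s₁ s₂) (restrictPairing p s₁ s₂) (restrictPairing p' s₁ s₂)
               ↭ consPart (⌊ ∣ polygon p p' s₁ ∣ /2⌋ ∸ 1) rest)
lemma3p4 S p p' P P' s₁ s₂ s₁∈S s₂∈S s₁≢s₂ ps₁≡s₂ = rest , typeOf-↭ , typeOf-restrict-↭
  where open Deletion P P' s₁∈S s₂∈S s₁≢s₂ ps₁≡s₂
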